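{- Let $G$ be a $3$-edge-connected undirected graph (possibly with multiple edges) and $T$ a DFS spanning tree of $G$ rooted at $r$. Let $v$ be a vertex with $l_1(M(v))\geq v$, let $m=M_{low1}(v)$, and let $u$ be the minimum vertex in $M^{ -1}(m)$ strictly greater than $v$. Then there exists a back-edge $e$ such that $B(v)=B(u)\sqcup\{e\}$ if and only if: $\mathit{b\_count}(v)=\mathit{b\_count}(u)+1$, $\mathit{low2}(M_{low2}(v))\geq v$, and either $M(v)$ has no $\mathit{low3}$ child or $\mathit{low1}(c_3(M(v)))\geq v$.
   Context: Vertices are identified with their DFS preorder numbers. A vertex $u$ is an ancestor of $v$ ($v$ a descendant of $u$) if the tree path from $r$ to $v$ contains $u$ (every vertex is an ancestor and descendant of itself). $T(v)$ denotes the set of descendants of $v$. Non-tree edges are back-edges; a back-edge is written $(x,y)$ with $x$ a descendant of $y$. $B(v)$ is the set of back-edges $(x,y)$ with $x$ a descendant of $v$ and $y$ a proper ancestor of $v$, and $\mathit{b\_count}(v)=|B(v)|$; $\sqcup$ denotes disjoint union. $l_1(v)$ is the smallest $y$ such that there is a back-edge $(v,y)$, or $v$ if none. For $v\neq r$, $\mathit{low1}(v)=\min\{y:\exists (x,y)\in B(v)\}$, $\mathit{low1D}(v)$ is a vertex $x$ such that $(x,\mathit{low1}(v))\in B(v)$ (a specific such back-edge being fixed), and $\mathit{low2}(v)$ is the minimum $y$ such that there is a back-edge $(x,y)\in B(v)$ other than the fixed back-edge $(\mathit{low1D}(v),\mathit{low1}(v))$. The children of a vertex $w$ sorted in non-decreasing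 order of $\mathit{low1}$ are $c_1(w),c_2(w),c_3(w),\dots$ (ties broken arbitrarily but fixed; $c_i(w)=\emptyset$ if $w$ has fewer than $i$ children); $c_3(w)$ is the $\mathit{low3}$ child of $w$. $\mathit{nca}$ denotes nearest common ancestor in $T$. $M(v)=\mathit{nca}\{x:\exists(x,y)\in B(v)\}$; $M_{low1}(v)=\mathit{nca}\{x:\exists(x,y)\in B(v),\ x\in T(c_1(M(v)))\}$; $M_{low2}(v)=\mathit{nca}\{x:\exists(x,y)\in B(v),\ x\in T(c_2(M(v)))\}$ (each undefined if the set is empty). For a vertex $m$, $M^{ -1}(m)=\{w: M(w)=m\}$. -}

module Defs where

open import Data.Nat as ℕ using (ℕ; zero; suc; _≤_; _<_; _⊓_)
open import Data.Bool using (Bool; true; false; if_then_else_)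
open import Data.Fin as Fin using (Fin; toℕ)
open import Data.Fin.Properties using (any?; _≟_)
open import Data.Product using (Σ; _×_; _,_; proj₁; proj₂; ∃)
open import Data.Sum using (_⊎_)
open import Data.List using (List; []; _∷_; filter; length; foldr; allFin)
open import Data.List.Relation.Unary.Unique.Propositional using (Unique)
open import Data.List.Relation.Unary.Linked using (Linked)
open import Data.List.Membership.Propositional using (_∈_)
open import Data.Maybe using (Maybe; just; nothing)
open import Function using (_⇔_)
open import Relation.Nullary using (¬_; Dec)
open import Relation.Nullary.Decidable using (¬?; _×-dec_; ⌊_⌋)
open import Relation.Binary.PropositionalEquality using (_≡_; _≢_)

-- Undirected multigraphs (loopless) on vertices Fin (suc n).
-- Edges are indexed by Fin E, so parallel edges are distinct indices.

record Graph : Set where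
  field
    n    : ℕ
    E    : ℕ
    ends : Fin E → Fin (suc n) × Fin (suc n)

Vtx : Graph → Set
Vtx G = Fin (suc (Graph.n G))

Edge : Graph → Set
Edge G = Fin (Graph.E G)

root : (G : Graph) → Vtx G
root G = Fin.zero

Joins : (G : Graph) → Edge G → Vtx G → Vtx G → Set
Joins G i a b = Graph.ends G i ≡ (a , b) ⊎ Graph.ends G i ≡ (b , a)

data Reach (G : Graph) (Ok : Edge G → Set) : Vtx G → Vtx G → Set where
  here : ∀ {a} → Reach G Ok a a
  step : ∀ {a b c} (i : Edge G) → Ok i → Joins G i a b → Reach G Ok b c → Reach G Ok a c

ThreeEdgeConnected : Graph → Set
ThreeEdgeConnected G =
  (e₁ e₂ : Edge G) (a b : Vtx G) → Reach G (λ i → i ≢ e₁ × i ≢ e₂) a b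

iter : {A : Set} → ℕ → (A → A) → A → A
iter zero    f a = a
iter (suc k) f a = f (iter k f a)

AncP : (G : Graph) → (Vtx G → Vtx G) → Vtx G → Vtx G → Set
AncP G p u v = Σ (Fin (suc (Graph.n G))) λ k → iter (toℕ k) p v ≡ u

-- A DFS spanning tree of G rooted at r = 0 whose vertex names are the
-- DFS preorder numbers.
record DFSTree (G : Graph) : Set where
  field
    parent      : Vtx G → Vtx G
    parent-root : parent (root G) ≡ root G
    parent-<    : ∀ v → v ≢ root G → toℕ (parent v) < toℕ v
    treeEdge    : Vtx G → Edge G
    treeEdge-ok : ∀ v → v ≢ root G → Joins G (treeEdge v) v (parent v)
    nontree     : ∀ i → ¬ (Σ (Vtx G) λ v → v ≢ root G × treeEdge v ≡ i) →
                  proj₁ (Graph.ends G i) ≢ proj₂ (Graph.ends G i) ×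
                  (AncP G parent (proj₁ (Graph.ends G i)) (proj₂ (Graph.ends G i)) ⊎
                   AncP G parent (proj₂ (Graph.ends G i)) (proj₁ (Graph.ends G i)))
    -- preorder numbering: T(v) is an interval starting at v
    preorder    : ∀ v w w' → toℕ v ≤ toℕ w' → toℕ w' ≤ toℕ w →
                  AncP G parent v w → AncP G parent v w'

module _ {G : Graph} (T : DFSTree G) where
  open Graph G
  open DFSTree T

  Anc : Vtx G → Vtx G → Set
  Anc = AncP G parent

  anc? : ∀ u v → Dec (Anc u v)
  anc? u v = any? λ k → iter (toℕ k) parent v ≟ u

  ProperAnc : Vtx G → Vtx G → Set
  ProperAnc u v = Anc u v × u ≢ v

  properAnc? : ∀ u v → Dec (ProperAnc u v)
  properAnc? u v = anc? u v ×-dec ¬? (u ≟ v)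

  IsTreeEdge : Edge G → Set
  IsTreeEdge i = Σ (Vtx G) λ v → v ≢ root G × treeEdge v ≡ i

  isTreeEdge? : ∀ i → Dec (IsTreeEdge i)
  isTreeEdge? i = any? λ v → ¬? (v ≟ root G) ×-dec (treeEdge v ≟ i)

  -- orientation of a back-edge (x , y): x is the endpoint with the larger
  -- preorder number (the descendant), y the one with the smaller (ancestor)
  xE : Edge G → Vtx G
  xE i with ends i
  ... | (a , b) = if toℕ a ℕ.<ᵇ toℕ b then b else a

  yE : Edge G → Vtx G
  yE i with ends i
  ... | (a , b) = if toℕ a ℕ.<ᵇ toℕ b then a else b

  InB : Vtx G → Edge G → Set
  InB v i = ¬ IsTreeEdge i × Anc v (xE i) × ProperAnc (yE i) v

  inB? : ∀ v i → Dec (InB v i)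
  inB? v i = ¬? (isTreeEdge? i) ×-dec anc? v (xE i) ×-dec properAnc? (yE i) v

  edgesB : Vtx G → List (Edge G)
  edgesB v = filter (inB? v) (allFin E)

  b-count : Vtx G → ℕ
  b-count v = length (edgesB v)

  minY : ℕ → List (Edge G) → ℕ
  minY d = foldr (λ i a → toℕ (yE i) ⊓ a) d

  removeFirst : (Edge G → Bool) → List (Edge G) → List (Edge G)
  removeFirst t []       = []
  removeFirst t (i ∷ is) = if t i then is else i ∷ removeFirst t is

  -- l₁(v): smallest y with a back-edge (v , y), or v if none
  l1 : Vtx G → ℕ
  l1 v = minY (toℕ v) (filter (λ i → ¬? (isTreeEdge? i) ×-dec (xE i ≟ v)) (allFin E))

  -- low1(v) (v itself if B(v) is empty, never the case for v ≠ r here)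
  low1 : Vtx G → ℕ
  low1 v = minY (toℕ v) (edgesB v)

  -- the fixed back-edge (low1D(v), low1(v)): the first edge of B(v) (in
  -- index order) whose y-endpoint is low1(v);
  -- low2(v): minimum y over B(v) minus that fixed edge
  low2 : Vtx G → ℕ
  low2 v = minY (toℕ v) (removeFirst (λ i → toℕ (yE i) ℕ.≡ᵇ low1 v) (edgesB v))

  Child : Vtx G → Vtx G → Set
  Child c w = c ≢ root G × parent c ≡ w

  IsNCA : (Vtx G → Set) → Vtx G → Set
  IsNCA S w = (Σ (Vtx G) S) ×
              (∀ x → S x → Anc w x) ×
              (∀ z → (∀ x → S x → Anc z x) → Anc z w)

  XB : Vtx G → Vtx G → Set
  XB v x = Σ (Edge G) λ i → InB v i × xE i ≡ x

  IsM : Vtx G → Vtx G → Set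
  IsM v m = IsNCA (XB v) m

-- A fixed ordering of the children of every vertex, non-decreasing in low1
-- (ties broken arbitrarily but fixed).
record ChildOrder {G : Graph} (T : DFSTree G) : Set where
  field
    ord        : Vtx G → List (Vtx G)
    ord-child  : ∀ w c → (c ∈ ord w) ⇔ Child T c w
    ord-unique : ∀ w → Unique (ord w)
    ord-sorted : ∀ w → Linked (λ a b → low1 T a ≤ low1 T b) (ord w)

nth : {A : Set} → List A → ℕ → Maybe A
nth []       k       = nothing
nth (a ∷ as) zero    = just a
nth (a ∷ as) (suc k) = nth as k

module _ {G : Graph} {T : DFSTree G} (C : ChildOrder T) where
  -- c k w = c_{k+1}(w)  (0-based index; nothing if w has ≤ k children)
  c : ℕ → Vtx G → Maybe (Vtx G)
  c k w = nth (ChildOrder.ord C w) k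

  -- M_low(k+1)(v) = m  (k = 0: M_low1, k = 1: M_low2)
  IsMlow : ℕ → Vtx G → Vtx G → Set
  IsMlow k v m = Σ (Vtx G) λ Mv → IsM T v Mv × Σ (Vtx G) λ ch →
                 c k Mv ≡ just ch × IsNCA T (λ x → XB T v x × Anc T ch x) m

IsMinAbove : {G : Graph} (T : DFSTree G) → Vtx G → Vtx G → Vtx G → Set
IsMinAbove {G} T m v u =
  IsM T u m × toℕ v < toℕ u × (∀ w → IsM T w m → toℕ v < toℕ w → toℕ u ≤ toℕ w)

DisjUnionOne : {G : Graph} (T : DFSTree G) → Vtx G → Vtx G → Edge G → Set
DisjUnionOne {G} T v u e =
  (∀ i → InB T v i ⇔ (InB T u i ⊎ i ≡ e)) × ¬ InB T u e

{-# OPTIONS --safe #-}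
-- Since l1(M(v)) ≥ v, every edge of B(v) leaves from the subtree of some child
-- of M(v); let c₁, c₂, c₃, … be these children in low1 order. M(u) = M_low1(v)
-- and v < u force u into T(c₁), so B(v) ∖ B(u) is the set of edges of B(v)
-- leaving from outside T(c₁), and it is nonempty because M(v) is the NCA of
-- their lower endpoints. Both sides of the equivalence say that this set is a
-- single edge e. On the left this is combined with B(u) ⊆ B(v), which, given
-- the single edge e, is equivalent to b_count(v) = b_count(u) + 1. On the
-- right, low2(M_low2(v)) ≥ v says that at most one edge of B(v) leaves from
-- T(c₂), and low1(c₃) ≥ v, by the low1 order, that none leaves from T(c₃),
-- T(c₄), ….
module Submission where

open import Defs
open import Data.Nat using (ℕ; suc; _≤_)
open import Data.Fin using (toℕ)
open import Data.Product using (Σ; _×_)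
open import Data.Sum using (_⊎_)
open import Data.Maybe using (just; nothing)
open import Function using (_⇔_)
open import Relation.Binary.PropositionalEquality using (_≡_)

open import Level using (0ℓ)
open import Data.Nat as ℕ using (zero; _<_; _+_; _∸_; z≤n; s≤s)
open import Data.Nat.Properties hiding (_≟_)
open import Data.Bool using (true; false) renaming (T to IsTrue)
open import Data.Fin using (fromℕ; fromℕ<)
open import Data.Fin.Properties
  using (_≟_; all?; any?; toℕ-injective; toℕ<n; toℕ-fromℕ; toℕ-fromℕ<; toℕ-inject; ¬∀⟶∃¬-smallest)
open import Data.Product using (_,_; proj₁; proj₂)
open import Data.Sum using (inj₁; inj₂)
open import Data.List using (List; []; _∷_; filter; length; allFin)
open import Data.List.Properties using (filter-some; filter-none)
import Data.List.Relation.Unary.All as All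
open import Data.List.Relation.Unary.Any as Any using (here; there)
open import Data.List.Relation.Unary.AllPairs using (_∷_)
open import Data.List.Relation.Unary.Linked using (Linked; _∷_)
open import Data.List.Relation.Unary.Unique.Propositional using (Unique)
open import Data.List.Relation.Unary.Unique.Propositional.Properties using (allFin⁺; filter⁺)
open import Data.List.Membership.Propositional using (_∈_)
open import Data.List.Membership.Propositional.Properties using (∈-filter⁺; ∈-filter⁻; ∈-allFin)
open import Data.Maybe.Properties using (just-injective)
open import Function using (Equivalence; mk⇔)
open import Relation.Nullary using (¬_; Dec; yes; no; contradiction)
open import Relation.Nullary.Decidable using (¬?; _×-dec_; _→-dec_; decidable-stable; map′)
open import Relation.Unary using (Pred; Decidable)
open import Relation.Unary.Properties using (_∩?_; ∁?)
open import Relation.Binary.PropositionalEquality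
  using (_≢_; refl; sym; trans; cong; subst; ≢-sym; module ≡-Reasoning)

module _ {A : Set} where

  count : {P : Pred A 0ℓ} → Decidable P → List A → ℕ
  count P? xs = length (filter P? xs)

  module _ {P : Pred A 0ℓ} (P? : Decidable P) where

    count≡0⇒¬ : ∀ {x xs} → count P? xs ≡ 0 → x ∈ xs → ¬ P x
    count≡0⇒¬ c≡0 x∈xs px =
      <-irrefl (sym c≡0) (filter-some P? (Any.map (λ { refl → px }) x∈xs))

    ¬⇒count≡0 : ∀ {xs} → (∀ {x} → x ∈ xs → ¬ P x) → count P? xs ≡ 0
    ¬⇒count≡0 {xs} ¬P = cong length (filter-none P? (All.tabulate ¬P))

    count≡1 : ∀ {e xs} → Unique xs → e ∈ xs → P e → (∀ {x} → x ∈ xs → P x → x ≡ e) →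
              count P? xs ≡ 1
    count≡1 {xs = x ∷ xs} (x∉xs ∷ uniq) e∈ pe only with P? x | e∈
    ... | yes px | here refl   = cong suc (¬⇒count≡0 λ y∈xs py →
                                   All.lookup x∉xs y∈xs (sym (only (there y∈xs) py)))
    ... | yes px | there e∈xs  = contradiction (only (here refl) px) (All.lookup x∉xs e∈xs)
    ... | no ¬px | here refl   = contradiction pe ¬px
    ... | no _   | there e∈xs  = count≡1 uniq e∈xs pe (λ y∈xs → only (there y∈xs))

  module _ {P Q : Pred A 0ℓ} (P? : Decidable P) (Q? : Decidable Q) where

    count-swap : ∀ xs → count Q? xs + count (P? ∩? ∁? Q?) xs ≡ count P? xs + count (Q? ∩? ∁? P?) xs
    count-swap [] = refl
    count-swap (x ∷ xs) with P? x | Q? x | count-swap xs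
    ... | yes _ | yes _ | ih = cong suc ih
    ... | yes _ | no _  | ih = trans (+-suc _ _) (cong suc ih)
    ... | no _  | yes _ | ih = trans (cong suc ih) (sym (+-suc _ _))
    ... | no _  | no _  | ih = ih

    count≡suc⇔⊆ : ∀ {e xs} → Unique xs → e ∈ xs → P e → ¬ Q e →
                  (∀ {x} → x ∈ xs → P x → ¬ Q x → x ≡ e) →
                  count P? xs ≡ suc (count Q? xs) ⇔ (∀ {x} → x ∈ xs → Q x → P x)
    count≡suc⇔⊆ {e} {xs} uniq e∈xs pe ¬qe only = mk⇔ ⊆-from-count count-from-⊆
      where
      open ≡-Reasoning
      cP = count P? xs
      cQ = count Q? xs
      cQ∖P = count (Q? ∩? ∁? P?) xs

      balance : cQ + 1 ≡ cP + cQ∖P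
      balance = begin
        cQ + 1                              ≡⟨ cong (cQ +_) (sym (count≡1 (P? ∩? ∁? Q?) uniq e∈xs (pe , ¬qe)
                                                 λ x∈xs (px , ¬qx) → only x∈xs px ¬qx)) ⟩
        cQ + count (P? ∩? ∁? Q?) xs         ≡⟨ count-swap xs ⟩
        cP + cQ∖P                           ∎

      ⊆-from-count : cP ≡ suc cQ → ∀ {x} → x ∈ xs → Q x → P x
      ⊆-from-count cP≡ {x} x∈xs qx with P? x
      ... | yes px = px
      ... | no ¬px = contradiction (qx , ¬px) (count≡0⇒¬ (Q? ∩? ∁? P?) Q∖P≡0 x∈xs)
        where
        Q∖P≡0 : cQ∖P ≡ 0
        Q∖P≡0 = +-cancelˡ-≡ cQ _ _ (suc-injective (begin
          suc (cQ + cQ∖P)  ≡⟨ cong (_+ cQ∖P) (sym cP≡) ⟩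
          cP + cQ∖P        ≡⟨ sym balance ⟩
          cQ + 1           ≡⟨ +-suc cQ 0 ⟩
          suc (cQ + 0)     ∎))

      count-from-⊆ : (∀ {x} → x ∈ xs → Q x → P x) → cP ≡ suc cQ
      count-from-⊆ Q⊆P = begin
        cP           ≡⟨ sym (+-identityʳ cP) ⟩
        cP + 0       ≡⟨ cong (cP +_) (sym (¬⇒count≡0 (Q? ∩? ∁? P?) λ x∈xs (qx , ¬px) → ¬px (Q⊆P x∈xs qx))) ⟩
        cP + cQ∖P    ≡⟨ sym balance ⟩
        cQ + 1       ≡⟨ +-comm cQ 1 ⟩
        suc cQ       ∎

  ∈⇒nth : ∀ {x : A} xs → x ∈ xs → Σ ℕ λ j → nth xs j ≡ just x
  ∈⇒nth (_ ∷ _)  (here refl) = 0 , refl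
  ∈⇒nth (_ ∷ xs) (there x∈xs) with j , eq ← ∈⇒nth xs x∈xs = suc j , eq

  nth⇒∈ : ∀ {x : A} xs j → nth xs j ≡ just x → x ∈ xs
  nth⇒∈ (_ ∷ _)  zero    refl = here refl
  nth⇒∈ (_ ∷ xs) (suc j) eq   = there (nth⇒∈ xs j eq)

  nth-injective : ∀ {x : A} xs → Unique xs → ∀ i j → nth xs i ≡ just x → nth xs j ≡ just x → i ≡ j
  nth-injective (_ ∷ _)  _            zero    zero    _  _  = refl
  nth-injective (_ ∷ xs) (x∉xs ∷ _)  zero    (suc j) refl q = contradiction refl (All.lookup x∉xs (nth⇒∈ xs j q))
  nth-injective (_ ∷ xs) (x∉xs ∷ _)  (suc i) zero    p refl = contradiction refl (All.lookup x∉xs (nth⇒∈ xs i p))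
  nth-injective (_ ∷ xs) (_ ∷ uniq)  (suc i) (suc j) p q    = cong suc (nth-injective xs uniq i j p q)

  nth-just-≤ : ∀ xs {i j b} → i ≤ j → nth xs j ≡ just b → Σ A λ a → nth xs i ≡ just a
  nth-just-≤ (x ∷ _)  {zero}              _         _  = x , refl
  nth-just-≤ (_ ∷ xs) {suc i} {suc j} (s≤s i≤j) eq = nth-just-≤ xs i≤j eq

  nth-monotone : (f : A → ℕ) → ∀ xs → Linked (λ a b → f a ≤ f b) xs →
                 ∀ {i j a b} → i ≤ j → nth xs i ≡ just a → nth xs j ≡ just b → f a ≤ f b
  nth-monotone f (_ ∷ _)      _         {zero}  {zero}  _         refl refl = ≤-refl
  nth-monotone f (_ ∷ y ∷ xs) (fx≤fy ∷ l) {zero}  {suc j} _         refl q    =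
    ≤-trans fx≤fy (nth-monotone f (y ∷ xs) l {zero} {j} z≤n refl q)
  nth-monotone f (_ ∷ y ∷ xs) (_ ∷ l)     {suc i} {suc j} (s≤s i≤j) p    q    =
    nth-monotone f (y ∷ xs) l i≤j p q
  nth-monotone f (_ ∷ [])     _           {_}     {suc _} _         _    ()

iter-+ : {A : Set} (a b : ℕ) (f : A → A) (x : A) → iter (a + b) f x ≡ iter a f (iter b f x)
iter-+ zero    b f x = refl
iter-+ (suc a) b f x = cong f (iter-+ a b f x)

iter-suc′ : {A : Set} (k : ℕ) (f : A → A) (x : A) → iter (suc k) f x ≡ iter k f (f x)
iter-suc′ k f x = trans (cong (λ t → iter t f x) (+-comm 1 k)) (iter-+ k 1 f x)

iter-fixed : {A : Set} (k : ℕ) (f : A → A) {x : A} → f x ≡ x → iter k f x ≡ x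
iter-fixed zero    f fx≡x = refl
iter-fixed (suc k) f fx≡x = trans (cong f (iter-fixed k f fx≡x)) fx≡x

module Ancestry {G : Graph} (T : DFSTree G) where
  open Graph G using (n)
  open DFSTree T

  V : Set
  V = Vtx G

  -- Ancestry with any number of parent steps: equivalent to `Anc T` (toAnc,
  -- fromAnc), whose step count is bounded by a Fin, but closed under composition.
  infix 4 _≼_
  _≼_ : V → V → Set
  u ≼ w = Σ ℕ λ k → iter k parent w ≡ u

  parent-≤ : ∀ x → toℕ (parent x) ≤ toℕ x
  parent-≤ x with x ≟ root G
  ... | yes refl = ≤-reflexive (cong toℕ parent-root)
  ... | no x≢r   = <⇒≤ (parent-< x x≢r)

  ≼⇒≤ : ∀ {u w} → u ≼ w → toℕ u ≤ toℕ w
  ≼⇒≤ (zero  , refl) = ≤-refl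
  ≼⇒≤ (suc k , refl) = ≤-trans (parent-≤ _) (≼⇒≤ (k , refl))

  ≼-refl : ∀ {u} → u ≼ u
  ≼-refl = 0 , refl

  ≼-trans : ∀ {a b c} → a ≼ b → b ≼ c → a ≼ c
  ≼-trans (i , refl) (j , refl) = i + j , iter-+ i j parent _

  ≼-antisym : ∀ {u w} → u ≼ w → w ≼ u → u ≡ w
  ≼-antisym u≼w w≼u = toℕ-injective (≤-antisym (≼⇒≤ u≼w) (≼⇒≤ w≼u))

  iter-≼ : ∀ x {i j} → i ≤ j → iter j parent x ≼ iter i parent x
  iter-≼ x {i} {j} i≤j =
    j ∸ i , trans (sym (iter-+ (j ∸ i) i parent x)) (cong (λ t → iter t parent x) (m∸n+n≡m i≤j))

  ≼-total : ∀ {a b x} → a ≼ x → b ≼ x → a ≼ b ⊎ b ≼ a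
  ≼-total {x = x} (i , refl) (j , refl) with ≤-total i j
  ... | inj₁ i≤j = inj₂ (iter-≼ x i≤j)
  ... | inj₂ j≤i = inj₁ (iter-≼ x j≤i)

  ≤⇒≼ : ∀ {a b x} → a ≼ x → b ≼ x → toℕ a ≤ toℕ b → a ≼ b
  ≤⇒≼ a≼x b≼x a≤b with ≼-total a≼x b≼x
  ... | inj₁ a≼b = a≼b
  ... | inj₂ b≼a with toℕ-injective (≤-antisym a≤b (≼⇒≤ b≼a))
  ...   | refl = ≼-refl

  iter-root : ∀ k x → toℕ x ≤ k → iter k parent x ≡ root G
  iter-root k x x≤k with x ≟ root G
  ... | yes refl = iter-fixed k parent parent-root
  iter-root (suc k) x x≤k | no x≢r =
    trans (iter-suc′ k parent x) (iter-root k (parent x) (≤-pred (≤-trans (parent-< x x≢r) x≤k)))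
  iter-root zero x x≤0 | no x≢r = contradiction (toℕ-injective (n≤0⇒n≡0 x≤0)) x≢r

  root-≼ : ∀ x → root G ≼ x
  root-≼ x = toℕ x , iter-root (toℕ x) x ≤-refl

  toAnc : ∀ {u w} → u ≼ w → Anc T u w
  toAnc {u} {w} (k , eq) with k ≤? n
  ... | yes k≤n = fromℕ< (s≤s k≤n) , subst (λ t → iter t parent w ≡ u) (sym (toℕ-fromℕ< (s≤s k≤n))) eq
  ... | no  k≰n = fromℕ n , (begin
    iter (toℕ (fromℕ n)) parent w  ≡⟨ cong (λ t → iter t parent w) (toℕ-fromℕ n) ⟩
    iter n parent w                ≡⟨ iter-root n w w≤n ⟩
    root G                         ≡⟨ sym (iter-root k w (≤-trans w≤n (<⇒≤ (≰⇒> k≰n)))) ⟩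
    iter k parent w                ≡⟨ eq ⟩
    u                              ∎)
    where
    open ≡-Reasoning
    w≤n = ≤-pred (toℕ<n w)

  fromAnc : ∀ {u w} → Anc T u w → u ≼ w
  fromAnc (k , eq) = toℕ k , eq

  _≼?_ : ∀ u w → Dec (u ≼ w)
  u ≼? w = map′ fromAnc toAnc (anc? T u w)

  ≼-parent : ∀ {u c} → u ≼ c → u ≢ c → u ≼ parent c
  ≼-parent (zero , refl) u≢c = contradiction refl u≢c
  ≼-parent {c = c} (suc k , eq) _ = k , trans (sym (iter-suc′ k parent c)) eq

  Child⇒≼ : ∀ {c m} → Child T c m → m ≼ c
  Child⇒≼ (_ , eq) = 1 , eq

  Child⇒< : ∀ {c m} → Child T c m → toℕ m < toℕ c
  Child⇒< (c≢r , refl) = parent-< _ c≢r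

  Child⇒⋠ : ∀ {c m} → Child T c m → ¬ c ≼ m
  Child⇒⋠ c-m c≼m = <⇒≱ (Child⇒< c-m) (≼⇒≤ c≼m)

  child-above : ∀ {m x} → m ≼ x → x ≢ m → Σ V λ c → Child T c m × c ≼ x
  child-above (k , eq) = go k eq
    where
    go : ∀ k {m x} → iter k parent x ≡ m → x ≢ m → Σ V λ c → Child T c m × c ≼ x
    go zero    refl x≢m = contradiction refl x≢m
    go (suc k) {m} {x} eq x≢m with iter k parent x ≟ m
    ... | yes eq′ = go k eq′ x≢m
    ... | no  c≢m = iter k parent x , (c≢r , eq) , (k , refl)
      where
      c≢r : iter k parent x ≢ root G
      c≢r c≡r = c≢m (trans c≡r (trans (sym parent-root) (trans (cong parent (sym c≡r)) eq)))

  child-unique : ∀ {c₁ c₂ m x} → Child T c₁ m → Child T c₂ m → c₁ ≼ x → c₂ ≼ x → c₁ ≡ c₂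
  child-unique {c₁} {c₂} c₁-m c₂-m c₁≼x c₂≼x with c₁ ≟ c₂
  ... | yes c₁≡c₂ = c₁≡c₂
  ... | no  c₁≢c₂ with ≼-total c₁≼x c₂≼x
  ...   | inj₁ c₁≼c₂ = contradiction (subst (c₁ ≼_) (proj₂ c₂-m) (≼-parent c₁≼c₂ c₁≢c₂)) (Child⇒⋠ c₁-m)
  ...   | inj₂ c₂≼c₁ = contradiction (subst (c₂ ≼_) (proj₂ c₁-m) (≼-parent c₂≼c₁ (≢-sym c₁≢c₂))) (Child⇒⋠ c₂-m)

  IsNCA-unique : ∀ {S a b} → IsNCA T S a → IsNCA T S b → a ≡ b
  IsNCA-unique {a = a} {b} (_ , a-common , a-least) (_ , b-common , b-least) =
    ≼-antisym (fromAnc (b-least a a-common)) (fromAnc (a-least b b-common))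

  module _ {S : V → Set} (S? : Decidable S) where
    private
      Common : V → Set
      Common z = ∀ x → S x → Anc T z x

      common? : Decidable Common
      common? z = all? (λ x → S? x →-dec anc? T z x)

    -- The NCA of S is the first vertex on the path from any x₀ ∈ S to the root
    -- that is an ancestor of all of S.
    nca-exists : ∀ {x₀} → S x₀ → Σ V (IsNCA T S)
    nca-exists {x₀} s₀
      with ¬∀⟶∃¬-smallest _ (λ k → ¬ Common (iter (toℕ k) parent x₀)) (λ k → ¬? (common? _)) root-common
      where
      root-common : ¬ ∀ k → ¬ Common (iter (toℕ k) parent x₀)
      root-common none = none (fromℕ n) (subst Common (sym root-reached) (λ x _ → toAnc (root-≼ x)))
        where
        root-reached : iter (toℕ (fromℕ n)) parent x₀ ≡ root G
        root-reached = trans (cong (λ t → iter t parent x₀) (toℕ-fromℕ n)) (iter-root n x₀ (≤-pred (toℕ<n x₀)))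
    ... | k , ¬¬common , below-k-uncommon =
      iter (toℕ k) parent x₀ , (x₀ , s₀) , decidable-stable (common? _) ¬¬common , least
      where
      least : ∀ z → Common z → Anc T z (iter (toℕ k) parent x₀)
      least z z-common with fromAnc (z-common x₀ s₀)
      ... | j , refl with j <? toℕ k
      ...   | yes j<k = contradiction z-common
                          (subst (λ t → ¬ Common (iter t parent x₀)) (trans (toℕ-inject (fromℕ< j<k)) (toℕ-fromℕ< j<k))
                            (below-k-uncommon (fromℕ< j<k)))
      ...   | no  j≮k = toAnc (iter-≼ x₀ (≮⇒≥ j≮k))

module BackEdges {G : Graph} (T : DFSTree G) where
  open Graph G using (E)
  open Ancestry T

  y : Edge G → ℕ
  y i = toℕ (yE T i)

  module _ {w i} (i∈B : InB T w i) where

    InB⇒≼x : w ≼ xE T i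
    InB⇒≼x = fromAnc (proj₁ (proj₂ i∈B))

    InB⇒y≼ : yE T i ≼ w
    InB⇒y≼ = fromAnc (proj₁ (proj₂ (proj₂ i∈B)))

    InB⇒y< : y i < toℕ w
    InB⇒y< = ≤∧≢⇒< (≼⇒≤ InB⇒y≼) (λ eq → proj₂ (proj₂ (proj₂ i∈B)) (toℕ-injective eq))

  InB-descend : ∀ {v w i} → InB T v i → v ≼ w → w ≼ xE T i → InB T w i
  InB-descend i∈Bv v≼w w≼x =
    proj₁ i∈Bv , toAnc w≼x , toAnc (≼-trans (InB⇒y≼ i∈Bv) v≼w) ,
    λ eq → <⇒≢ (<-≤-trans (InB⇒y< i∈Bv) (≼⇒≤ v≼w)) (cong toℕ eq)

  InB-ascend : ∀ {v w i} → InB T w i → v ≼ w → y i < toℕ v → InB T v i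
  InB-ascend i∈Bw v≼w y<v =
    proj₁ i∈Bw , toAnc (≼-trans v≼w (InB⇒≼x i∈Bw)) ,
    toAnc (≤⇒≼ (InB⇒y≼ i∈Bw) v≼w (<⇒≤ y<v)) , λ eq → <⇒≢ y<v (cong toℕ eq)

  ∈-edgesB⁺ : ∀ {w i} → InB T w i → i ∈ edgesB T w
  ∈-edgesB⁺ {w} {i} = ∈-filter⁺ (inB? T w) (∈-allFin i)

  ∈-edgesB⁻ : ∀ {w i} → i ∈ edgesB T w → InB T w i
  ∈-edgesB⁻ {w} i∈ = proj₂ (∈-filter⁻ (inB? T w) {xs = allFin E} i∈)

  edgesB-unique : ∀ w → Unique (edgesB T w)
  edgesB-unique w = filter⁺ (inB? T w) (allFin⁺ E)

  minY-≤ : ∀ d {i} is → i ∈ is → minY T d is ≤ y i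
  minY-≤ d (_ ∷ is) (here refl) = m⊓n≤m _ _
  minY-≤ d (_ ∷ is) (there i∈) = ≤-trans (m⊓n≤n _ _) (minY-≤ d is i∈)

  minY-≥ : ∀ {d k} is → (∀ {i} → i ∈ is → k ≤ y i) → k ≤ d → k ≤ minY T d is
  minY-≥ []       _ k≤d = k≤d
  minY-≥ (i ∷ is) k≤ k≤d = ⊓-glb (k≤ (here refl)) (minY-≥ is (λ i∈ → k≤ (there i∈)) k≤d)

  minY-<⁻ : ∀ {d k} is → minY T d is < k → k ≤ d → Σ (Edge G) λ i → i ∈ is × y i < k
  minY-<⁻ []       min<k k≤d = contradiction k≤d (<⇒≱ min<k)
  minY-<⁻ (i ∷ is) min<k k≤d with y i <? _
  ... | yes yi<k = i , here refl , yi<k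
  ... | no  yi≮k with j , j∈ , yj<k ← minY-<⁻ is (≰⇒> λ k≤min → <⇒≱ min<k (⊓-glb (≮⇒≥ yi≮k) k≤min)) k≤d
    = j , there j∈ , yj<k

  low1-<⁺ : ∀ {w i k} → InB T w i → y i < k → low1 T w < k
  low1-<⁺ {w} i∈B yi<k = ≤-<-trans (minY-≤ (toℕ w) (edgesB T w) (∈-edgesB⁺ i∈B)) yi<k

  low1-<⁻ : ∀ {w k} → k ≤ toℕ w → low1 T w < k → Σ (Edge G) λ i → InB T w i × y i < k
  low1-<⁻ {w} k≤w low1<k with i , i∈ , yi<k ← minY-<⁻ (edgesB T w) low1<k k≤w = i , ∈-edgesB⁻ i∈ , yi<k

  l1-≤ : ∀ {i} → ¬ IsTreeEdge T i → l1 T (xE T i) ≤ y i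
  l1-≤ {i} i-nontree = minY-≤ (toℕ (xE T i)) _
    (∈-filter⁺ (λ j → ¬? (isTreeEdge? T j) ×-dec (xE T j ≟ xE T i)) (∈-allFin i) (i-nontree , refl))

  removeFirst-keeps-one : ∀ t {a b} is → a ∈ is → b ∈ is → a ≢ b →
                          a ∈ removeFirst T t is ⊎ b ∈ removeFirst T t is
  removeFirst-keeps-one t (i ∷ is) a∈ b∈ a≢b with t i | a∈ | b∈
  ... | true  | here refl | here refl = contradiction refl a≢b
  ... | true  | here refl | there b∈′ = inj₂ b∈′
  ... | true  | there a∈′ | _         = inj₁ a∈′
  ... | false | here refl | _         = inj₁ (here refl)
  ... | false | there _   | here refl = inj₂ (here refl)
  ... | false | there a∈′ | there b∈′ with removeFirst-keeps-one t is a∈′ b∈′ a≢b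
  ...   | inj₁ a∈″ = inj₁ (there a∈″)
  ...   | inj₂ b∈″ = inj₂ (there b∈″)

  ∈-removeFirst⁻ : ∀ t {e} is → Unique is → IsTrue (t e) → (∀ {a} → a ∈ is → IsTrue (t a) → a ≡ e) →
                   ∀ {a} → a ∈ removeFirst T t is → a ∈ is × a ≢ e
  ∈-removeFirst⁻ t (i ∷ is) (i∉is ∷ uniq) te first-match a∈ with t i in ti
  ... | true  = there a∈ , λ { refl → All.lookup i∉is a∈ (first-match (here refl) (subst IsTrue (sym ti) _)) }
  ∈-removeFirst⁻ t (i ∷ is) _ te _ (here refl) | false = here refl , λ { refl → subst IsTrue ti te }
  ∈-removeFirst⁻ t (i ∷ is) (_ ∷ uniq) te first-match (there a∈) | false
    with a∈is , a≢e ← ∈-removeFirst⁻ t is uniq te (λ a∈′ → first-match (there a∈′)) a∈ = there a∈is , a≢e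

  low2-< : ∀ {w i j k} → InB T w i → InB T w j → i ≢ j → y i < k → y j < k → low2 T w < k
  low2-< {w} i∈B j∈B i≢j yi<k yj<k
    with removeFirst-keeps-one (λ a → y a ℕ.≡ᵇ low1 T w) (edgesB T w) (∈-edgesB⁺ i∈B) (∈-edgesB⁺ j∈B) i≢j
  ... | inj₁ i∈ = ≤-<-trans (minY-≤ (toℕ w) _ i∈) yi<k
  ... | inj₂ j∈ = ≤-<-trans (minY-≤ (toℕ w) _ j∈) yj<k

  low2-≥ : ∀ {w e k} → k ≤ toℕ w → InB T w e → y e < k → (∀ {i} → InB T w i → y i < k → i ≡ e) →
           k ≤ low2 T w
  low2-≥ {w} {e} {k} k≤w e∈B ye<k small⇒e =
    minY-≥ _ (λ i∈ → let i∈is , i≢e = ∈-removeFirst⁻ isLow1 (edgesB T w) (edgesB-unique w) e-isLow1 isLow1⇒e i∈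
                     in large (∈-edgesB⁻ i∈is) i≢e) k≤w
    where
    isLow1 = λ a → y a ℕ.≡ᵇ low1 T w

    large : ∀ {i} → InB T w i → i ≢ e → k ≤ y i
    large {i} i∈B i≢e with y i <? k
    ... | yes yi<k = contradiction (small⇒e i∈B yi<k) i≢e
    ... | no  yi≮k = ≮⇒≥ yi≮k

    low1≡ye : low1 T w ≡ y e
    low1≡ye = ≤-antisym (minY-≤ (toℕ w) _ (∈-edgesB⁺ e∈B)) (minY-≥ _ ye≤ (≤-trans (<⇒≤ ye<k) k≤w))
      where
      ye≤ : ∀ {i} → i ∈ edgesB T w → y e ≤ y i
      ye≤ {i} i∈ with i ≟ e
      ... | yes refl = ≤-refl
      ... | no  i≢e  = ≤-trans (<⇒≤ ye<k) (large (∈-edgesB⁻ i∈) i≢e)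

    e-isLow1 : IsTrue (isLow1 e)
    e-isLow1 = ≡⇒≡ᵇ (y e) (low1 T w) (sym low1≡ye)

    isLow1⇒e : ∀ {a} → a ∈ edgesB T w → IsTrue (isLow1 a) → a ≡ e
    isLow1⇒e a∈ a-low1 = small⇒e (∈-edgesB⁻ a∈) (≤-<-trans (≤-reflexive (trans (≡ᵇ⇒≡ _ _ a-low1) low1≡ye)) ye<k)

module ChildrenOfM {G : Graph} {T : DFSTree G} (C : ChildOrder T)
               {v Mv : Vtx G} (v-M : IsM T v Mv) (v≤l1 : toℕ v ≤ l1 T Mv) where
  open ChildOrder C
  open Ancestry T
  open BackEdges T

  v≼Mv : v ≼ Mv
  v≼Mv = fromAnc (proj₂ (proj₂ v-M) v λ { _ (i , i∈B , refl) → proj₁ (proj₂ i∈B) })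

  Mv≼x : ∀ {i} → InB T v i → Mv ≼ xE T i
  Mv≼x {i} i∈B = fromAnc (proj₁ (proj₂ v-M) (xE T i) (i , i∈B , refl))

  -- the one use of l1(M(v)) ≥ v
  x≢Mv : ∀ {i} → InB T v i → xE T i ≢ Mv
  x≢Mv i∈B refl = <⇒≱ (<-≤-trans (InB⇒y< i∈B) v≤l1) (l1-≤ (proj₁ i∈B))

  Below : Vtx G → Edge G → Set
  Below ch i = InB T v i × ch ≼ xE T i

  child-below : ∀ {i} → InB T v i → Σ (Vtx G) λ ch → Child T ch Mv × Below ch i
  child-below i∈B with ch , ch-child , ch≼x ← child-above (Mv≼x i∈B) (x≢Mv i∈B) = ch , ch-child , i∈B , ch≼x

  v≼child : ∀ {ch} → Child T ch Mv → v ≼ ch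
  v≼child ch-child = ≼-trans v≼Mv (Child⇒≼ ch-child)

  low1-child-<⁺ : ∀ {ch i} → Child T ch Mv → Below ch i → low1 T ch < toℕ v
  low1-child-<⁺ ch-child (i∈B , ch≼x) = low1-<⁺ (InB-descend i∈B (v≼child ch-child) ch≼x) (InB⇒y< i∈B)

  low1-child-<⁻ : ∀ {ch} → Child T ch Mv → low1 T ch < toℕ v → Σ (Edge G) (Below ch)
  low1-child-<⁻ ch-child low1<v
    with i , i∈Bch , yi<v ← low1-<⁻ (≼⇒≤ (v≼child ch-child)) low1<v
    = i , InB-ascend i∈Bch (v≼child ch-child) yi<v , InB⇒≼x i∈Bch

  child⇒index : ∀ {ch} → Child T ch Mv → Σ ℕ λ j → c C j Mv ≡ just ch
  child⇒index {ch} ch-child = ∈⇒nth (ord Mv) (Equivalence.from (ord-child Mv ch) ch-child)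

  index⇒child : ∀ {j ch} → c C j Mv ≡ just ch → Child T ch Mv
  index⇒child {j} {ch} eq = Equivalence.to (ord-child Mv ch) (nth⇒∈ (ord Mv) j eq)

  index-≢ : ∀ {i j a b} → c C i Mv ≡ just a → c C j Mv ≡ just b → i ≢ j → a ≢ b
  index-≢ {i} {j} a-index b-index i≢j refl = i≢j (nth-injective (ord Mv) (ord-unique Mv) i j a-index b-index)

  earlier-child-low1-< : ∀ {i j ch e} → i ≤ j → c C j Mv ≡ just ch → Below ch e →
                         Σ (Vtx G) λ a → c C i Mv ≡ just a × low1 T a < toℕ v
  earlier-child-low1-< i≤j ch-index ch-below with a , a-index ← nth-just-≤ (ord Mv) i≤j ch-index =
    a , a-index ,
    ≤-<-trans (nth-monotone (low1 T) (ord Mv) (ord-sorted Mv) i≤j a-index ch-index)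
              (low1-child-<⁺ (index⇒child ch-index) ch-below)

  XB? : ∀ x → Dec (XB T v x)
  XB? x = any? λ i → inB? T v i ×-dec (xE T i ≟ x)

  -- M(v) is the NCA of the lower endpoints, so they cannot all lie below c₁(M(v))
  second-child-below : ∀ {c₁} → c C 0 Mv ≡ just c₁ →
                       Σ (Vtx G) λ c₂ → c C 1 Mv ≡ just c₂ × Σ (Edge G) (Below c₂)
  second-child-below {c₁} c₁-index with any? (λ i → inB? T v i ×-dec ¬? (anc? T c₁ (xE T i)))
  ... | no none = contradiction (fromAnc (proj₂ (proj₂ v-M) c₁ below-c₁)) (Child⇒⋠ (index⇒child c₁-index))
    where
    below-c₁ : ∀ x → XB T v x → Anc T c₁ x
    below-c₁ _ (i , i∈B , refl) = decidable-stable (anc? T c₁ (xE T i)) λ c₁⋠x → none (i , i∈B , c₁⋠x)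
  ... | yes (i , i∈B , c₁⋠x) with ch , ch-child , ch-below ← child-below i∈B with child⇒index ch-child
  ...   | zero , ch-index = contradiction (subst (λ a → Anc T a (xE T i)) (just-injective (trans (sym ch-index) c₁-index))
                                                   (toAnc (proj₂ ch-below))) c₁⋠x
  ...   | suc j , ch-index with c₂ , c₂-index , low1<v ← earlier-child-low1-< (s≤s z≤n) ch-index ch-below =
    c₂ , c₂-index , low1-child-<⁻ (index⇒child c₂-index) low1<v

module BvVersusBu {G : Graph} {T : DFSTree G} (C : ChildOrder T) {v Mv m u c₁ : Vtx G}
              (v-M : IsM T v Mv) (v≤l1 : toℕ v ≤ l1 T Mv)
              (c₁-index : c C 0 Mv ≡ just c₁) (m-nca : IsNCA T (λ x → XB T v x × Anc T c₁ x) m)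
              (u-M : IsM T u m) (v<u : toℕ v < toℕ u) where
  open Graph G using (E)
  open Ancestry T
  open BackEdges T
  open ChildrenOfM C v-M v≤l1

  c₁-child : Child T c₁ Mv
  c₁-child = index⇒child c₁-index

  c₂ : Vtx G
  c₂ = proj₁ (second-child-below c₁-index)

  c₂-index : c C 1 Mv ≡ just c₂
  c₂-index = proj₁ (proj₂ (second-child-below c₁-index))

  i₂ : Edge G
  i₂ = proj₁ (proj₂ (proj₂ (second-child-below c₁-index)))

  i₂-below : Below c₂ i₂
  i₂-below = proj₂ (proj₂ (proj₂ (second-child-below c₁-index)))

  c₂-child : Child T c₂ Mv
  c₂-child = index⇒child c₂-index

  c₂≢c₁ : c₂ ≢ c₁
  c₂≢c₁ = index-≢ c₂-index c₁-index λ ()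

  c₁≼m : c₁ ≼ m
  c₁≼m = fromAnc (proj₂ (proj₂ m-nca) c₁ λ _ → proj₂)

  m≼x : ∀ {i} → Below c₁ i → m ≼ xE T i
  m≼x {i} (i∈B , c₁≼x) = fromAnc (proj₁ (proj₂ m-nca) (xE T i) ((i , i∈B , refl) , toAnc c₁≼x))

  u≼m : u ≼ m
  u≼m = fromAnc (proj₂ (proj₂ u-M) u λ { _ (i , i∈B , refl) → proj₁ (proj₂ i∈B) })

  v≼u : v ≼ u
  v≼u = ≤⇒≼ (≼-trans (v≼child c₁-child) c₁≼m) u≼m (<⇒≤ v<u)

  -- Otherwise u would be an ancestor of M(v), so i₂ ∈ B(u); but the lower
  -- endpoints of B(u) lie below M(u) = m, which is below c₁.
  c₁≼u : c₁ ≼ u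
  c₁≼u with ≼-total c₁≼m u≼m
  ... | inj₁ c₁≼u = c₁≼u
  ... | inj₂ u≼c₁ with u ≟ c₁
  ...   | yes refl = ≼-refl
  ...   | no  u≢c₁ = contradiction (child-unique c₂-child c₁-child (proj₂ i₂-below) c₁≼x₂) c₂≢c₁
    where
    u≼Mv : u ≼ Mv
    u≼Mv = subst (u ≼_) (proj₂ c₁-child) (≼-parent u≼c₁ u≢c₁)
    i₂∈Bu : InB T u i₂
    i₂∈Bu = InB-descend (proj₁ i₂-below) v≼u (≼-trans u≼Mv (≼-trans (Child⇒≼ c₂-child) (proj₂ i₂-below)))
    c₁≼x₂ : c₁ ≼ xE T i₂
    c₁≼x₂ = ≼-trans c₁≼m (fromAnc (proj₁ (proj₂ u-M) (xE T i₂) (i₂ , i₂∈Bu , refl)))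

  below-c₁⇒InB-u : ∀ {i} → Below c₁ i → InB T u i
  below-c₁⇒InB-u i-below = InB-descend (proj₁ i-below) v≼u (≼-trans u≼m (m≼x i-below))

  InB-u⇒c₁≼x : ∀ {i} → InB T u i → c₁ ≼ xE T i
  InB-u⇒c₁≼x i∈Bu = ≼-trans c₁≼u (InB⇒≼x i∈Bu)

  -- exactly the edges of B(v) ∖ B(u)
  Outer : Edge G → Set
  Outer i = InB T v i × ¬ c₁ ≼ xE T i

  below-other-child⇒Outer : ∀ {ch i} → Child T ch Mv → ch ≢ c₁ → Below ch i → Outer i
  below-other-child⇒Outer ch-child ch≢c₁ (i∈B , ch≼x) =
    i∈B , λ c₁≼x → ch≢c₁ (child-unique ch-child c₁-child ch≼x c₁≼x)

  i₂-outer : Outer i₂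
  i₂-outer = below-other-child⇒Outer c₂-child c₂≢c₁ i₂-below

  OnlyOuter : Edge G → Set
  OnlyOuter e = Outer e × (∀ {i} → Outer i → i ≡ e)

  DisjUnionOne⇒OnlyOuter : ∀ {e} → DisjUnionOne T v u e → OnlyOuter e
  DisjUnionOne⇒OnlyOuter {e} (split , e∉Bu) = (e∈Bv , λ c₁≼x → e∉Bu (below-c₁⇒InB-u (e∈Bv , c₁≼x))) , only
    where
    e∈Bv : InB T v e
    e∈Bv = Equivalence.from (split e) (inj₂ refl)
    only : ∀ {i} → Outer i → i ≡ e
    only {i} (i∈Bv , c₁⋠x) with Equivalence.to (split i) i∈Bv
    ... | inj₁ i∈Bu = contradiction (InB-u⇒c₁≼x i∈Bu) c₁⋠x
    ... | inj₂ i≡e  = i≡e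

  DisjUnionOne⇔count : ∀ {e} → OnlyOuter e → DisjUnionOne T v u e ⇔ (b-count T v ≡ suc (b-count T u))
  DisjUnionOne⇔count {e} ((e∈Bv , c₁⋠xe) , only) =
    mk⇔ (λ (split , _) → Equivalence.from counting λ _ i∈Bu → Equivalence.from (split _) (inj₁ i∈Bu))
        (λ count → (λ i → mk⇔ split-Bv (join (Equivalence.to counting count (∈-allFin i)))) , e∉Bu)
    where
    e∉Bu : ¬ InB T u e
    e∉Bu e∈Bu = c₁⋠xe (InB-u⇒c₁≼x e∈Bu)

    counting = count≡suc⇔⊆ (inB? T v) (inB? T u) (allFin⁺ E) (∈-allFin e) e∈Bv e∉Bu
                 λ _ i∈Bv i∉Bu → only (i∈Bv , λ c₁≼x → i∉Bu (below-c₁⇒InB-u (i∈Bv , c₁≼x)))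

    split-Bv : ∀ {i} → InB T v i → InB T u i ⊎ i ≡ e
    split-Bv {i} i∈Bv with c₁ ≼? xE T i
    ... | yes c₁≼x = inj₁ (below-c₁⇒InB-u (i∈Bv , c₁≼x))
    ... | no  c₁⋠x = inj₂ (only (i∈Bv , c₁⋠x))

    join : ∀ {i} → (InB T u i → InB T v i) → InB T u i ⊎ i ≡ e → InB T v i
    join Bu⊆Bv (inj₁ i∈Bu) = Bu⊆Bv i∈Bu
    join _     (inj₂ refl) = e∈Bv

  module Mlow2 {w} (w-nca : IsNCA T (λ x → XB T v x × Anc T c₂ x) w) where

    c₂≼w : c₂ ≼ w
    c₂≼w = fromAnc (proj₂ (proj₂ w-nca) c₂ λ _ → proj₂)

    v≼w : v ≼ w
    v≼w = ≼-trans (v≼child c₂-child) c₂≼w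

    below-c₂⇒InB-w : ∀ {i} → Below c₂ i → InB T w i
    below-c₂⇒InB-w {i} (i∈B , c₂≼x) =
      InB-descend i∈B v≼w (fromAnc (proj₁ (proj₂ w-nca) (xE T i) ((i , i∈B , refl) , toAnc c₂≼x)))

    InB-w⇒below-c₂ : ∀ {i} → InB T w i → y i < toℕ v → Below c₂ i
    InB-w⇒below-c₂ i∈Bw yi<v = InB-ascend i∈Bw v≼w yi<v , ≼-trans c₂≼w (InB⇒≼x i∈Bw)

  Low2Condition : Set
  Low2Condition = ∀ w → IsMlow C 1 v w → toℕ v ≤ low2 T w

  Low1c₃Condition : Set
  Low1c₃Condition = c C 2 Mv ≡ nothing ⊎ Σ (Vtx G) λ ch → c C 2 Mv ≡ just ch × toℕ v ≤ low1 T ch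

  Low1c₃Condition-at : Low1c₃Condition → ∀ {c₃} → c C 2 Mv ≡ just c₃ → toℕ v ≤ low1 T c₃
  Low1c₃Condition-at (inj₁ no-c₃) c₃-index = contradiction (trans (sym c₃-index) no-c₃) λ ()
  Low1c₃Condition-at (inj₂ (_ , c₃-index′ , v≤low1)) c₃-index with trans (sym c₃-index) c₃-index′
  ... | refl = v≤low1

  OnlyOuter⇒Low2Condition : ∀ {e} → OnlyOuter e → Low2Condition
  OnlyOuter⇒Low2Condition {e} (e-outer , only) w (Mv′ , v-M′ , c₂′ , c₂′-index , w-nca)
    with IsNCA-unique v-M′ v-M
  ... | refl with just-injective (trans (sym c₂′-index) c₂-index)
  ...   | refl = low2-≥ (≼⇒≤ v≼w) (below-c₂⇒InB-w e-below) (InB⇒y< (proj₁ e-outer))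
                   λ i∈Bw yi<v → only (below-other-child⇒Outer c₂-child c₂≢c₁ (InB-w⇒below-c₂ i∈Bw yi<v))
    where
    open Mlow2 w-nca
    e-below : Below c₂ e
    e-below = subst (Below c₂) (only i₂-outer) i₂-below

  OnlyOuter⇒Low1c₃Condition : ∀ {e} → OnlyOuter e → Low1c₃Condition
  OnlyOuter⇒Low1c₃Condition {e} (_ , only) with c C 2 Mv in c₃-index
  ... | nothing = inj₁ refl
  ... | just c₃ = inj₂ (c₃ , refl , ≮⇒≥ λ low1<v → c₃≢c₂ (below-c₃-is-below-c₂ (low1-child-<⁻ c₃-child low1<v)))
    where
    c₃-child = index⇒child c₃-index
    c₃≢c₂ : c₃ ≢ c₂
    c₃≢c₂ = index-≢ c₃-index c₂-index λ ()
    c₃≢c₁ : c₃ ≢ c₁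
    c₃≢c₁ = index-≢ c₃-index c₁-index λ ()
    below-c₃-is-below-c₂ : Σ (Edge G) (Below c₃) → c₃ ≡ c₂
    below-c₃-is-below-c₂ (i , i-below) =
      child-unique c₃-child c₂-child (proj₂ i-below)
        (subst (λ j → c₂ ≼ xE T j)
               (trans (only i₂-outer) (sym (only (below-other-child⇒Outer c₃-child c₃≢c₁ i-below))))
               (proj₂ i₂-below))

  conditions⇒OnlyOuter : Low2Condition → Low1c₃Condition → OnlyOuter i₂
  conditions⇒OnlyOuter low2≥v low1c₃≥v = i₂-outer , only
    where
    Mlow2-exists : Σ (Vtx G) (IsNCA T λ x → XB T v x × Anc T c₂ x)
    Mlow2-exists = nca-exists (λ x → XB? x ×-dec anc? T c₂ x) ((i₂ , proj₁ i₂-below , refl) , toAnc (proj₂ i₂-below))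

    at-most-one-below-c₂ : ∀ {i} → Below c₂ i → i ≡ i₂
    at-most-one-below-c₂ {i} i-below with i ≟ i₂
    ... | yes i≡i₂ = i≡i₂
    ... | no  i≢i₂ = contradiction (low2≥v w (Mv , v-M , c₂ , c₂-index , w-nca))
                       (<⇒≱ (low2-< (below-c₂⇒InB-w i-below) (below-c₂⇒InB-w i₂-below) i≢i₂
                                    (InB⇒y< (proj₁ i-below)) (InB⇒y< (proj₁ i₂-below))))
      where
      w = proj₁ Mlow2-exists
      w-nca = proj₂ Mlow2-exists
      open Mlow2 w-nca

    only : ∀ {i} → Outer i → i ≡ i₂
    only {i} (i∈Bv , c₁⋠x) with ch , ch-child , ch-below ← child-below i∈Bv with child⇒index ch-child
    ... | zero , ch-index =
      contradiction (subst (_≼ xE T i) (just-injective (trans (sym ch-index) c₁-index)) (proj₂ ch-below)) c₁⋠x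
    ... | suc zero , ch-index =
      at-most-one-below-c₂ (subst (λ a → Below a i) (just-injective (trans (sym ch-index) c₂-index)) ch-below)
    ... | suc (suc _) , ch-index with c₃ , c₃-index , low1<v ← earlier-child-low1-< (s≤s (s≤s z≤n)) ch-index ch-below =
      contradiction (Low1c₃Condition-at low1c₃≥v c₃-index) (<⇒≱ low1<v)

lemma7 : (G : Graph) (T : DFSTree G) → ThreeEdgeConnected G → (C : ChildOrder T) →
         (v Mv m u : Vtx G) → IsM T v Mv → toℕ v ≤ l1 T Mv →
         IsMlow C 0 v m → IsMinAbove T m v u →
         (Σ (Edge G) λ e → DisjUnionOne T v u e) ⇔
         ((b-count T v ≡ suc (b-count T u)) ×
          (∀ w → IsMlow C 1 v w → toℕ v ≤ low2 T w) ×
          (c C 2 Mv ≡ nothing ⊎ Σ (Vtx G) λ ch → c C 2 Mv ≡ just ch × toℕ v ≤ low1 T ch))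
lemma7 G T _ C v Mv m u v-M v≤l1 (Mv′ , v-M′ , c₁ , c₁-index , m-nca) (u-M , v<u , _)
  with Ancestry.IsNCA-unique T v-M′ v-M
... | refl = mk⇔
  (λ (e , split) → let only = DisjUnionOne⇒OnlyOuter split in
    Equivalence.to (DisjUnionOne⇔count only) split , OnlyOuter⇒Low2Condition only , OnlyOuter⇒Low1c₃Condition only)
  (λ (count , low2≥v , low1c₃≥v) →
    i₂ , Equivalence.from (DisjUnionOne⇔count (conditions⇒OnlyOuter low2≥v low1c₃≥v)) count)
  where open BvVersusBu C v-M v≤l1 c₁-index m-nca u-M v<u
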